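{- Let $n$ be a composite integer with $4\nmid n$. Then every circulant digraph of order $n$ that is a $(K,H)$-generalized wreath circulant digraph is not normal.
   Context: $\Gamma(\mathbb{Z}_n,S)$ has vertex set $\mathbb{Z}_n$ and arc set $\{(u,v):u-v\in S\}$, $S\subseteq\mathbb{Z}_n\setminus\{0\}$. For subgroups $\{0\}\ne K\le H\ne\mathbb{Z}_n$ of $\mathbb{Z}_n$, it is a $(K,H)$-generalized wreath circulant digraph if $S\setminus H$ is a union of cosets of $K$. It is normal if the translation group $\langle\rho\rangle$, $\rho(i)=i+1$, is a normal subgroup of ${\rm Aut}(\Gamma)$. -}

module Defs where

open import Data.Nat using (ℕ; zero; suc; _+_; _∸_; NonZero)
open import Data.Nat.DivMod using (_%_; m%n<n)
open import Data.Fin using (Fin; toℕ; fromℕ<)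
open import Data.Product using (Σ; ∃; _×_)
open import Data.Empty using (⊥)
open import Relation.Nullary using (¬_)
open import Relation.Binary.PropositionalEquality using (_≡_; _≢_)
open import Function.Bundles using (_↔_; Inverse)

-- The cyclic group ℤ_n, represented by Fin n with arithmetic modulo n.
module _ {n : ℕ} .{{_ : NonZero n}} where

  ι : ℕ → Fin n
  ι m = fromℕ< (m%n<n m n)

  0# : Fin n
  0# = ι 0

  infixl 6 _⊕_ _⊖_
  _⊕_ : Fin n → Fin n → Fin n
  a ⊕ b = ι (toℕ a + toℕ b)

  ⊝_ : Fin n → Fin n
  ⊝ a = ι (n ∸ toℕ a)

  _⊖_ : Fin n → Fin n → Fin n
  a ⊖ b = a ⊕ (⊝ b)

  Subset : Set₁
  Subset = Fin n → Set

  record IsSubgroup (H : Subset) : Set where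
    field
      has-0   : H 0#
      closed-⊕ : ∀ {a b} → H a → H b → H (a ⊕ b)
      closed-⊝ : ∀ {a} → H a → H (⊝ a)

  _⊆_ : Subset → Subset → Set
  A ⊆ B = ∀ x → A x → B x

  NonTrivial : Subset → Set
  NonTrivial K = ∃ λ k → K k × k ≢ 0#

  Proper : Subset → Set
  Proper H = ∃ λ x → ¬ H x

  ConnectionSet : Subset → Set
  ConnectionSet S = ∀ x → S x → x ≢ 0#

  -- S ∖ H is a union of cosets of K: every coset x + K meeting S ∖ H lies in S ∖ H
  GenWreathCond : (S K H : Subset) → Set
  GenWreathCond S K H =
    ∀ x → S x → ¬ H x → ∀ k → K k → S (x ⊕ k) × ¬ H (x ⊕ k)

  IsGenWreath : (S K H : Subset) → Set
  IsGenWreath S K H =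
    IsSubgroup K × IsSubgroup H × NonTrivial K × K ⊆ H × Proper H × GenWreathCond S K H

  Arc : Subset → Fin n → Fin n → Set
  Arc S u v = S (u ⊖ v)

  IsAut : (S : Subset) → (Fin n ↔ Fin n) → Set
  IsAut S σ = ∀ u v → (Arc S u v → Arc S (to u) (to v)) × (Arc S (to u) (to v) → Arc S u v)
    where open Inverse σ

  ρ : Fin n → Fin n
  ρ i = i ⊕ ι 1

  ρ^ : ℕ → Fin n → Fin n
  ρ^ zero    x = x
  ρ^ (suc k) x = ρ (ρ^ k x)

  -- ⟨ρ⟩ is normal in Aut(Γ): σ ρ^k σ⁻¹ ∈ ⟨ρ⟩ for every σ ∈ Aut(Γ) and every k
  IsNormal : Subset → Set
  IsNormal S = ∀ (σ : Fin n ↔ Fin n) → IsAut S σ → ∀ k →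
    ∃ λ j → ∀ x → Inverse.to σ (ρ^ k (Inverse.from σ x)) ≡ ρ^ j x

-- Let k ≠ 0 lie in K. The switch σ fixing ℤₙ ∖ H pointwise and translating H by k
-- is an automorphism of Γ(ℤₙ, S): a difference lying in H is unchanged, and a
-- difference outside H only moves inside its K-coset. If ⟨ρ⟩ were normal, then
-- σρσ⁻¹ = ρʲ, which says that the displacement s(y) = σ(y) − y satisfies
-- s(y + 1) = s(y) + k. As H is proper, 1 ∉ H, so s(1) = 0 and s(0) = k give
-- 2k = 0, and s(2) = k ≠ 0 gives 2 ∈ H. Then k = n/2 is odd because 4 ∤ n, so
-- 1 ∈ ⟨k, 2⟩ ⊆ H, a contradiction.
module Submission where

open import Defs
open import Data.Nat using (ℕ; NonZero)
open import Data.Nat.Divisibility using (_∣_)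
open import Data.Nat.Primality using (Composite)
open import Relation.Nullary using (¬_)

open import Algebra.Bundles using (AbelianGroup)
open import Algebra.Structures using (IsAbelianGroup)
import Algebra.Properties.AbelianGroup as AbelianGroupProperties
import Algebra.Properties.CommutativeSemigroup as CommutativeSemigroupProperties
open import Data.Empty using (⊥-elim)
open import Data.Fin using (Fin; toℕ; zero; suc)
open import Data.Fin.Properties using (toℕ-fromℕ<; toℕ-injective; toℕ<n)
open import Data.Nat using (zero; suc; _+_; _*_; _∸_; _≤_; s≤s; >-nonZero⁻¹)
open import Data.Nat.DivMod using (_%_; _/_; m%n<n; %-distribˡ-+; n%n≡0; m<n⇒m%n≡m; m≡m%n+[m/n]*n)
open import Data.Nat.Divisibility using (divides; m%n≡0⇒n∣m)
open import Data.Nat.Properties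
  using (+-comm; +-assoc; +-identityʳ; *-identityʳ; *-distribˡ-+; m+[n∸m]≡n; m+n≡0⇒m≡0;
         <⇒≤; <⇒≱; +-mono-<; +-monoʳ-≤; m≤m+n)
open import Data.Product using (∃; _,_; proj₁)
open import Function.Bundles using (_↔_; _⇔_; mk⇔; mk↔ₛ′; Equivalence)
open import Level using (0ℓ)
open import Relation.Binary.PropositionalEquality
open import Relation.Nullary using (yes; no)
open import Relation.Nullary.Decidable using (¬¬-excluded-middle)
open import Relation.Nullary.Negation using (DoubleNegation)
open import Relation.Unary using (Decidable)
open ≡-Reasoning

module _ {n : ℕ} .{{_ : NonZero n}} where

  toℕ-ι : ∀ m → toℕ (ι {n} m) ≡ m % n
  toℕ-ι m = toℕ-fromℕ< (m%n<n m n)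

  toℕ-0# : toℕ (0# {n}) ≡ 0
  toℕ-0# = trans (toℕ-ι 0) (m<n⇒m%n≡m (>-nonZero⁻¹ n))

  ι-toℕ : ∀ (a : Fin n) → ι (toℕ a) ≡ a
  ι-toℕ a = toℕ-injective (trans (toℕ-ι (toℕ a)) (m<n⇒m%n≡m (toℕ<n a)))

  ι-n : ι n ≡ 0#
  ι-n = toℕ-injective (trans (toℕ-ι n) (trans (n%n≡0 n) (sym toℕ-0#)))

  ι-+ : ∀ a b → ι {n} (a + b) ≡ ι a ⊕ ι b
  ι-+ a b = toℕ-injective (begin
    toℕ (ι (a + b))                 ≡⟨ toℕ-ι (a + b) ⟩
    (a + b) % n                     ≡⟨ %-distribˡ-+ a b n ⟩
    (a % n + b % n) % n             ≡⟨ cong₂ (λ x y → (x + y) % n) (toℕ-ι a) (toℕ-ι b) ⟨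
    (toℕ (ι a) + toℕ (ι b)) % n     ≡⟨ toℕ-ι _ ⟨
    toℕ (ι a ⊕ ι b)                 ∎)

  ⊕-assoc : ∀ (a b c : Fin n) → (a ⊕ b) ⊕ c ≡ a ⊕ (b ⊕ c)
  ⊕-assoc a b c = begin
    ι (toℕ a + toℕ b) ⊕ c                 ≡⟨ cong (ι (toℕ a + toℕ b) ⊕_) (ι-toℕ c) ⟨
    ι (toℕ a + toℕ b) ⊕ ι (toℕ c)         ≡⟨ ι-+ (toℕ a + toℕ b) (toℕ c) ⟨
    ι (toℕ a + toℕ b + toℕ c)             ≡⟨ cong ι (+-assoc (toℕ a) (toℕ b) (toℕ c)) ⟩
    ι (toℕ a + (toℕ b + toℕ c))           ≡⟨ ι-+ (toℕ a) (toℕ b + toℕ c) ⟩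
    ι (toℕ a) ⊕ ι (toℕ b + toℕ c)         ≡⟨ cong (_⊕ (b ⊕ c)) (ι-toℕ a) ⟩
    a ⊕ (b ⊕ c)                           ∎

  ⊕-comm : ∀ (a b : Fin n) → a ⊕ b ≡ b ⊕ a
  ⊕-comm a b = cong ι (+-comm (toℕ a) (toℕ b))

  ⊕-identityʳ : ∀ (a : Fin n) → a ⊕ 0# ≡ a
  ⊕-identityʳ a =
    trans (cong ι (trans (cong (toℕ a +_) toℕ-0#) (+-identityʳ (toℕ a)))) (ι-toℕ a)

  ⊕-inverseʳ : ∀ (a : Fin n) → a ⊕ ⊝ a ≡ 0#
  ⊕-inverseʳ a = begin
    a ⊕ ⊝ a                        ≡⟨ cong (_⊕ ⊝ a) (ι-toℕ a) ⟨
    ι (toℕ a) ⊕ ι (n ∸ toℕ a)      ≡⟨ ι-+ (toℕ a) (n ∸ toℕ a) ⟨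
    ι (toℕ a + (n ∸ toℕ a))        ≡⟨ cong ι (m+[n∸m]≡n (<⇒≤ (toℕ<n a))) ⟩
    ι n                            ≡⟨ ι-n ⟩
    0#                             ∎

  ⊕-⊝-isAbelianGroup : IsAbelianGroup _≡_ _⊕_ 0# ⊝_
  ⊕-⊝-isAbelianGroup = record
    { isGroup = record
      { isMonoid = record
        { isSemigroup = record
          { isMagma = record { isEquivalence = isEquivalence ; ∙-cong = cong₂ _⊕_ }
          ; assoc = ⊕-assoc
          }
        ; identity = (λ a → trans (⊕-comm 0# a) (⊕-identityʳ a)) , ⊕-identityʳ
        }
      ; inverse = (λ a → trans (⊕-comm (⊝ a) a) (⊕-inverseʳ a)) , ⊕-inverseʳ
      ; ⁻¹-cong = cong ⊝_
      }
    ; comm = ⊕-comm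
    }

  ⊕-⊝-abelianGroup : AbelianGroup 0ℓ 0ℓ
  ⊕-⊝-abelianGroup = record { isAbelianGroup = ⊕-⊝-isAbelianGroup }

  open AbelianGroup ⊕-⊝-abelianGroup public using (identityˡ; inverseˡ)
  open AbelianGroupProperties ⊕-⊝-abelianGroup public
    using ( ⁻¹-involutive; ⁻¹-∙-comm; ⁻¹-anti-homo‿-; ∙-cancelˡ; xyx⁻¹≈y
          ; //-rightDividesˡ; //-rightDividesʳ )
  open CommutativeSemigroupProperties (AbelianGroup.commutativeSemigroup ⊕-⊝-abelianGroup) public
    using (interchange; x∙yz≈y∙xz)

  ⊕-⊖-interchange : ∀ (u a v b : Fin n) → (u ⊕ a) ⊖ (v ⊕ b) ≡ (u ⊖ v) ⊕ (a ⊖ b)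
  ⊕-⊖-interchange u a v b =
    trans (cong ((u ⊕ a) ⊕_) (sym (⁻¹-∙-comm v b))) (interchange u a (⊝ v) (⊝ b))

  ρ^-translation : ∀ j (x : Fin n) → ρ^ j x ≡ x ⊕ ι j
  ρ^-translation zero    x = sym (⊕-identityʳ x)
  ρ^-translation (suc j) x = begin
    ρ^ j x ⊕ ι 1         ≡⟨ cong (_⊕ ι 1) (ρ^-translation j x) ⟩
    (x ⊕ ι j) ⊕ ι 1      ≡⟨ ⊕-assoc x (ι j) (ι 1) ⟩
    x ⊕ (ι j ⊕ ι 1)      ≡⟨ cong (x ⊕_) (trans (⊕-comm (ι j) (ι 1)) (sym (ι-+ 1 j))) ⟩
    x ⊕ ι (suc j)        ∎

  order-two⇒double≡n : ∀ {k : Fin n} → k ≢ 0# → k ⊕ k ≡ 0# → toℕ k + toℕ k ≡ n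
  order-two⇒double≡n {k} k≢0 k⊕k≡0 with m%n≡0⇒n∣m (toℕ k + toℕ k) n 2k%n≡0
    where
    2k%n≡0 : (toℕ k + toℕ k) % n ≡ 0
    2k%n≡0 = trans (sym (toℕ-ι _)) (trans (cong toℕ k⊕k≡0) toℕ-0#)
  ... | divides zero 2k≡0 =
    ⊥-elim (k≢0 (toℕ-injective (trans (m+n≡0⇒m≡0 (toℕ k) 2k≡0) (sym toℕ-0#))))
  ... | divides (suc zero) 2k≡n = trans 2k≡n (+-identityʳ n)
  ... | divides (suc (suc q)) 2k≡[2+q]n =
    ⊥-elim (<⇒≱ (+-mono-< (toℕ<n k) (toℕ<n k))
                (subst (n + n ≤_) (sym 2k≡[2+q]n) (+-monoʳ-≤ n (m≤m+n n (q * n)))))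

  order-two⇒odd : ¬ 4 ∣ n → ∀ {k : Fin n} → k ≢ 0# → k ⊕ k ≡ 0# →
                  ∃ λ q → k ≡ ι 1 ⊕ ι (q * 2)
  order-two⇒odd 4∤n {k} k≢0 k⊕k≡0
    with toℕ k % 2 | m%n<n (toℕ k) 2 | m≡m%n+[m/n]*n (toℕ k) 2
  ... | zero | _ | k≡q*2 =
    ⊥-elim (4∤n (divides q (begin
      n                      ≡⟨ order-two⇒double≡n k≢0 k⊕k≡0 ⟨
      toℕ k + toℕ k          ≡⟨ cong₂ _+_ k≡q*2 k≡q*2 ⟩
      q * 2 + q * 2          ≡⟨ *-distribˡ-+ q 2 2 ⟨
      q * 4                  ∎)))
    where
    q : ℕ
    q = toℕ k / 2
  ... | suc zero | _ | k≡1+q*2 =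
    toℕ k / 2 , trans (sym (ι-toℕ k)) (trans (cong ι k≡1+q*2) (ι-+ 1 _))
  ... | suc (suc _) | s≤s (s≤s ()) | _

module SubgroupProperties {n : ℕ} .{{_ : NonZero n}} {H : Subset {n}} (H-sub : IsSubgroup H) where
  open IsSubgroup H-sub

  ∈-cancelʳ : ∀ {a b} → H b → H (a ⊕ b) → H a
  ∈-cancelʳ {a} {b} b∈H a⊕b∈H = subst H (//-rightDividesʳ b a) (closed-⊕ a⊕b∈H (closed-⊝ b∈H))

  ∈-⊖⇒∈ : ∀ {u v} → H (u ⊖ v) → H v → H u
  ∈-⊖⇒∈ {u} {v} u⊖v∈H v∈H = subst H (//-rightDividesˡ v u) (closed-⊕ u⊖v∈H v∈H)

  ∈-⊖⇒∈⇔∈ : ∀ {u v} → H (u ⊖ v) → H u ⇔ H v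
  ∈-⊖⇒∈⇔∈ {u} {v} u⊖v∈H =
    mk⇔ (∈-⊖⇒∈ (subst H (⁻¹-anti-homo‿- u v) (closed-⊝ u⊖v∈H))) (∈-⊖⇒∈ u⊖v∈H)

  ∈-ι-multiple : ∀ {a} → H (ι a) → ∀ q → H (ι (q * a))
  ∈-ι-multiple a∈H zero    = has-0
  ∈-ι-multiple {a} a∈H (suc q) = subst H (sym (ι-+ a (q * a))) (closed-⊕ a∈H (∈-ι-multiple a∈H q))

  proper⇒ι1∉ : Proper H → ¬ H (ι 1)
  proper⇒ι1∉ (x , x∉H) 1∈H =
    x∉H (subst H (trans (cong ι (*-identityʳ (toℕ x))) (ι-toℕ x)) (∈-ι-multiple 1∈H (toℕ x)))

genWreath-coset-⇔ : ∀ {n} .{{_ : NonZero n}} {S K H : Subset {n}} →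
                    IsSubgroup H → IsSubgroup K → K ⊆ H → GenWreathCond S K H →
                    ∀ {x c} → K c → ¬ H x → S x ⇔ S (x ⊕ c)
genWreath-coset-⇔ {S = S} {H = H} H-sub K-sub K⊆H wreath {x} {c} c∈K x∉H = mk⇔
  (λ x∈S → proj₁ (wreath x x∈S x∉H c c∈K))
  (λ x⊕c∈S → subst S (//-rightDividesʳ c x)
                (proj₁ (wreath (x ⊕ c) x⊕c∈S x⊕c∉H (⊝ c) (IsSubgroup.closed-⊝ K-sub c∈K))))
  where
  x⊕c∉H : ¬ H (x ⊕ c)
  x⊕c∉H x⊕c∈H = x∉H (SubgroupProperties.∈-cancelʳ H-sub (K⊆H c c∈K) x⊕c∈H)

¬¬-decidable : ∀ {m} (P : Fin m → Set) → DoubleNegation (Decidable P)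
¬¬-decidable {zero}  P ¬P? = ¬P? λ ()
¬¬-decidable {suc m} P ¬P? =
  ¬¬-excluded-middle λ P0? → ¬¬-decidable (λ i → P (suc i)) λ Psuc? →
  ¬P? λ { zero → P0? ; (suc i) → Psuc? i }

module Switch {n : ℕ} .{{_ : NonZero n}} {H : Subset {n}} (H-sub : IsSubgroup H) (H? : Decidable H)
              (k : Fin n) (k∈H : H k) where
  open IsSubgroup H-sub
  open SubgroupProperties H-sub

  shift : Fin n → Fin n
  shift x with H? x
  ... | yes _ = k
  ... | no  _ = 0#

  shift-∈ : ∀ {x} → H x → shift x ≡ k
  shift-∈ {x} x∈H with H? x
  ... | yes _    = refl
  ... | no  x∉H = ⊥-elim (x∉H x∈H)

  shift-∉ : ∀ {x} → ¬ H x → shift x ≡ 0#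
  shift-∉ {x} x∉H with H? x
  ... | yes x∈H = ⊥-elim (x∉H x∈H)
  ... | no  _   = refl

  shift≢0#⇒∈ : ∀ {x} → shift x ≢ 0# → H x
  shift≢0#⇒∈ {x} shift≢0 with H? x
  ... | yes x∈H = x∈H
  ... | no  _   = ⊥-elim (shift≢0 refl)

  shift-∈-subgroup : ∀ {K} → IsSubgroup K → K k → ∀ x → K (shift x)
  shift-∈-subgroup K-sub k∈K x with H? x
  ... | yes _ = k∈K
  ... | no  _ = IsSubgroup.has-0 K-sub

  shift-cong : ∀ {u v} → H (u ⊖ v) → shift u ≡ shift v
  shift-cong {u} {v} u⊖v∈H with H? u | H? v
  ... | yes _   | yes _   = refl
  ... | no  _   | no  _   = refl
  ... | yes u∈H | no  v∉H = ⊥-elim (v∉H (Equivalence.to (∈-⊖⇒∈⇔∈ u⊖v∈H) u∈H))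
  ... | no  u∉H | yes v∈H = ⊥-elim (u∉H (Equivalence.from (∈-⊖⇒∈⇔∈ u⊖v∈H) v∈H))

  switch : Fin n → Fin n
  switch x = x ⊕ shift x

  unswitch : Fin n → Fin n
  unswitch x = x ⊖ shift x

  unswitch-switch : ∀ x → unswitch (switch x) ≡ x
  unswitch-switch x = begin
    switch x ⊖ shift (switch x)   ≡⟨ cong (switch x ⊖_) (shift-cong switch-x⊖x∈H) ⟩
    (x ⊕ shift x) ⊖ shift x       ≡⟨ //-rightDividesʳ (shift x) x ⟩
    x                             ∎
    where
    switch-x⊖x∈H : H (switch x ⊖ x)
    switch-x⊖x∈H = subst H (sym (xyx⁻¹≈y x (shift x))) (shift-∈-subgroup H-sub k∈H x)

  switch-unswitch : ∀ y → switch (unswitch y) ≡ y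
  switch-unswitch y = begin
    unswitch y ⊕ shift (unswitch y)   ≡⟨ cong (unswitch y ⊕_) (shift-cong unswitch-y⊖y∈H) ⟩
    (y ⊖ shift y) ⊕ shift y           ≡⟨ //-rightDividesˡ (shift y) y ⟩
    y                                 ∎
    where
    unswitch-y⊖y∈H : H (unswitch y ⊖ y)
    unswitch-y⊖y∈H = subst H (sym (xyx⁻¹≈y y (⊝ shift y))) (closed-⊝ (shift-∈-subgroup H-sub k∈H y))

  σ : Fin n ↔ Fin n
  σ = mk↔ₛ′ switch unswitch switch-unswitch unswitch-switch

  σ-isAut : ∀ {S K} → IsSubgroup K → K ⊆ H → GenWreathCond S K H → K k → IsAut S σ
  σ-isAut {S} {K} K-sub K⊆H wreath k∈K u v = Equivalence.to arc⇔ , Equivalence.from arc⇔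
    where
    switch-⊖ : switch u ⊖ switch v ≡ (u ⊖ v) ⊕ (shift u ⊖ shift v)
    switch-⊖ = ⊕-⊖-interchange u (shift u) v (shift v)

    arc⇔ : S (u ⊖ v) ⇔ S (switch u ⊖ switch v)
    arc⇔ with H? (u ⊖ v)
    ... | yes u⊖v∈H = mk⇔ (subst S (sym switch-⊖≡⊖)) (subst S switch-⊖≡⊖)
      where
      switch-⊖≡⊖ : switch u ⊖ switch v ≡ u ⊖ v
      switch-⊖≡⊖ = begin
        switch u ⊖ switch v                 ≡⟨ switch-⊖ ⟩
        (u ⊖ v) ⊕ (shift u ⊖ shift v)       ≡⟨ cong (λ s → (u ⊖ v) ⊕ (s ⊖ shift v)) (shift-cong u⊖v∈H) ⟩
        (u ⊖ v) ⊕ (shift v ⊖ shift v)       ≡⟨ cong ((u ⊖ v) ⊕_) (⊕-inverseʳ (shift v)) ⟩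
        (u ⊖ v) ⊕ 0#                        ≡⟨ ⊕-identityʳ (u ⊖ v) ⟩
        u ⊖ v                               ∎
    ... | no u⊖v∉H = subst (λ z → S (u ⊖ v) ⇔ S z) (sym switch-⊖)
                       (genWreath-coset-⇔ H-sub K-sub K⊆H wreath shift-⊖∈K u⊖v∉H)
      where
      shift-⊖∈K : K (shift u ⊖ shift v)
      shift-⊖∈K = IsSubgroup.closed-⊕ K-sub (shift-∈-subgroup K-sub k∈K u)
                    (IsSubgroup.closed-⊝ K-sub (shift-∈-subgroup K-sub k∈K v))

  σρσ⁻¹≡ρ^ : ℕ → Set
  σρσ⁻¹≡ρ^ j = ∀ x → switch (ρ (unswitch x)) ≡ ρ^ j x

  σρσ⁻¹≡ρ^⇒shift-step : ∀ j → σρσ⁻¹≡ρ^ j → ∀ y → ι 1 ⊕ shift (y ⊕ ι 1) ≡ shift y ⊕ ι j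
  σρσ⁻¹≡ρ^⇒shift-step j conj y = ∙-cancelˡ y _ _ (begin
    y ⊕ (ι 1 ⊕ shift (y ⊕ ι 1))         ≡⟨ ⊕-assoc y (ι 1) _ ⟨
    switch (y ⊕ ι 1)                     ≡⟨ cong (λ z → switch (ρ z)) (unswitch-switch y) ⟨
    switch (ρ (unswitch (switch y)))     ≡⟨ conj (switch y) ⟩
    ρ^ j (switch y)                      ≡⟨ ρ^-translation j (switch y) ⟩
    (y ⊕ shift y) ⊕ ι j                  ≡⟨ ⊕-assoc y (shift y) (ι j) ⟩
    y ⊕ (shift y ⊕ ι j)                  ∎)

  σρσ⁻¹≡ρ^⇒shift-step-k : ¬ H (ι 1) → ∃ σρσ⁻¹≡ρ^ → ∀ y → shift (y ⊕ ι 1) ≡ shift y ⊕ k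
  σρσ⁻¹≡ρ^⇒shift-step-k 1∉H (j , conj) y = ∙-cancelˡ (ι 1) _ _ (begin
    ι 1 ⊕ shift (y ⊕ ι 1)      ≡⟨ σρσ⁻¹≡ρ^⇒shift-step j conj y ⟩
    shift y ⊕ ι j              ≡⟨ cong (shift y ⊕_) ι1⊕k≡ιj ⟨
    shift y ⊕ (ι 1 ⊕ k)        ≡⟨ x∙yz≈y∙xz (shift y) (ι 1) k ⟩
    ι 1 ⊕ (shift y ⊕ k)        ∎)
    where
    ι1⊕k≡ιj : ι 1 ⊕ k ≡ ι j
    ι1⊕k≡ιj = begin
      ι 1 ⊕ k                          ≡⟨ cong (ι 1 ⊕_) (shift-∈ has-0) ⟨
      ι 1 ⊕ shift 0#                   ≡⟨ cong (λ z → ι 1 ⊕ shift z) (inverseˡ (ι 1)) ⟨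
      ι 1 ⊕ shift (⊝ ι 1 ⊕ ι 1)        ≡⟨ σρσ⁻¹≡ρ^⇒shift-step j conj (⊝ ι 1) ⟩
      shift (⊝ ι 1) ⊕ ι j              ≡⟨ cong (_⊕ ι j) (shift-∉ -1∉H) ⟩
      0# ⊕ ι j                         ≡⟨ identityˡ (ι j) ⟩
      ι j                              ∎
      where
      -1∉H : ¬ H (⊝ ι 1)
      -1∉H -1∈H = 1∉H (subst H (⁻¹-involutive (ι 1)) (closed-⊝ -1∈H))

  σρσ⁻¹≡ρ^⇒k⊕k≡0# : ¬ H (ι 1) → ∃ σρσ⁻¹≡ρ^ → k ⊕ k ≡ 0#
  σρσ⁻¹≡ρ^⇒k⊕k≡0# 1∉H conj = begin
    k ⊕ k                 ≡⟨ cong (_⊕ k) (shift-∈ has-0) ⟨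
    shift 0# ⊕ k          ≡⟨ σρσ⁻¹≡ρ^⇒shift-step-k 1∉H conj 0# ⟨
    shift (0# ⊕ ι 1)      ≡⟨ cong shift (identityˡ (ι 1)) ⟩
    shift (ι 1)           ≡⟨ shift-∉ 1∉H ⟩
    0#                    ∎

  σρσ⁻¹≡ρ^⇒ι2∈H : ¬ H (ι 1) → k ≢ 0# → ∃ σρσ⁻¹≡ρ^ → H (ι 2)
  σρσ⁻¹≡ρ^⇒ι2∈H 1∉H k≢0 conj = shift≢0#⇒∈ (λ shift-2≡0 → k≢0 (trans (sym shift-2≡k) shift-2≡0))
    where
    shift-2≡k : shift (ι 2) ≡ k
    shift-2≡k = begin
      shift (ι 2)              ≡⟨ cong shift (ι-+ 1 1) ⟩
      shift (ι 1 ⊕ ι 1)        ≡⟨ σρσ⁻¹≡ρ^⇒shift-step-k 1∉H conj (ι 1) ⟩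
      shift (ι 1) ⊕ k          ≡⟨ cong (_⊕ k) (shift-∉ 1∉H) ⟩
      0# ⊕ k                   ≡⟨ identityˡ k ⟩
      k                        ∎

-- Membership in H need not be decidable, but since
-- the goal is a negation we may assume it is.
lemma3p3 : (n : ℕ) .{{_ : NonZero n}} → Composite n → ¬ (4 ∣ n) →
    (S K H : Subset {n}) → ConnectionSet S → IsGenWreath S K H → ¬ IsNormal S
lemma3p3 n _ 4∤n S K H _ (K-sub , H-sub , (k , k∈K , k≢0) , K⊆H , H-proper , wreath) normal =
  ¬¬-decidable H λ H? →
    let open Switch H-sub H? k k∈H
        conj = normal σ (σ-isAut K-sub K⊆H wreath k∈K) 1
        (q , k≡1+2q) = order-two⇒odd 4∤n k≢0 (σρσ⁻¹≡ρ^⇒k⊕k≡0# 1∉H conj)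
        2q∈H = ∈-ι-multiple (σρσ⁻¹≡ρ^⇒ι2∈H 1∉H k≢0 conj) q
    in 1∉H (∈-cancelʳ 2q∈H (subst H k≡1+2q k∈H))
  where
  open SubgroupProperties H-sub
  k∈H : H k
  k∈H = K⊆H k k∈K

  1∉H : ¬ H (ι 1)
  1∉H = proper⇒ι1∉ H-proper
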